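{- Let $\lambda$ be a nonempty partition. The following are equivalent: (i) $\lambda$ is a hook; (ii) $\ell(\lambda)=m(\lambda)$; (iii) $\mathrm{Sk}_\lambda(x)=\mathrm{Sk}_{\lambda,\ell(\lambda)}(x)$.
   Context: A nonempty partition $\lambda$ is a hook if $\lambda_2\le1$, i.e. $\lambda=(\lambda_1,1^{\ell(\lambda)-1})$, where $\ell(\lambda)$ is the number of rows. A (strong) composition of $n$ is a finite sequence $\alpha$ of positive integers summing to $n$, $\ell(\alpha)$ its length. For $\lambda\vdash n$ and $T\in\mathrm{SYT}(\lambda)$ (standard Young tableaux of shape $\lambda$), $\mathrm{Des}\,T=\{i\in\{1,\dots,n-1\}: i+1 \text{ lies in a row strictly below the row of } i\}$; if $\mathrm{Des}\,T=\{a_1<\dots<a_k\}$, $\mathrm{des}\,T=(a_1,a_2-a_1,\dots,a_k-a_{k-1},n-a_k)$. $m(\lambda)=\max\{\ell(\mathrm{des}\,T):T\in\mathrm{SYT}(\lambda)\}$. With $f_{\lambda\alpha}=\#\{T\in\mathrm{SYT}(\lambda):\mathrm{des}\,T=\alpha\}$ and $x^\alpha=x_1^{\alpha_1}\cdots x_{\ell(\alpha)}^{\alpha_{\ell(\alpha)}}$: $\mathrm{Sk}_\lambda(x)=\sum_{\alpha\models n}f_{\lambda\alpha}x^\alpha$ and $\mathrm{Sk}_{\lambda,i}(x)=\sum_{\alpha\models n,\ \ell(\alpha)=i}f_{\lambda\alpha}x^\alpha$. -}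

module Defs where

open import Data.Nat using (ℕ; zero; suc; _∸_; _≤_; _⊔_; _<ᵇ_; _≡ᵇ_)
open import Data.Nat.Properties using (_≟_)
open import Data.Bool using (Bool; true; false; _∧_; if_then_else_)
open import Data.List using (List; []; _∷_; [_]; map; concatMap; take; drop; length; upTo; filter; filterᵇ; foldr)
open import Data.Bool.ListAction using (any; all)
open import Data.Nat.ListAction using (sum)
open import Data.List.Properties using (≡-dec)
open import Data.List.Relation.Unary.All using (All)
open import Data.List.Relation.Unary.Linked using (Linked)
open import Data.Product using (_×_)
open import Relation.Binary.PropositionalEquality using (_≡_)

IsPartition : List ℕ → Set
IsPartition lam = All (λ k → 1 ≤ k) lam × Linked (λ a b → b ≤ a) lam

IsComposition : ℕ → List ℕ → Set
IsComposition n α = All (λ k → 1 ≤ k) α × sum α ≡ n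

second : List ℕ → ℕ
second (_ ∷ b ∷ _) = b
second _ = 0

IsHook : List ℕ → Set
IsHook lam = second lam ≤ 1

insertAll : ℕ → List ℕ → List (List ℕ)
insertAll x [] = [ x ∷ [] ]
insertAll x (y ∷ ys) = (x ∷ y ∷ ys) ∷ map (y ∷_) (insertAll x ys)

perms : List ℕ → List (List ℕ)
perms [] = [ [] ]
perms (x ∷ xs) = concatMap (insertAll x) (perms xs)

chunk : List ℕ → List ℕ → List (List ℕ)
chunk [] w = []
chunk (k ∷ ks) w = take k w ∷ chunk ks (drop k w)

-- A filling of shape λ (list of rows, top row first, English convention)
-- with the entries 1..n each used once; all such fillings, each exactly once.
fillings : List ℕ → List (List (List ℕ))
fillings lam = map (chunk lam) (perms (map suc (upTo (sum lam))))

incᵇ : List ℕ → Bool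
incᵇ (a ∷ b ∷ xs) = (a <ᵇ b) ∧ incᵇ (b ∷ xs)
incᵇ _ = true

colsᵇ : List ℕ → List ℕ → Bool
colsᵇ (a ∷ as) (b ∷ bs) = (a <ᵇ b) ∧ colsᵇ as bs
colsᵇ [] (_ ∷ _) = false
colsᵇ _ [] = true

colsAllᵇ : List (List ℕ) → Bool
colsAllᵇ (r ∷ r' ∷ rs) = colsᵇ r r' ∧ colsAllᵇ (r' ∷ rs)
colsAllᵇ _ = true

isSYTᵇ : List (List ℕ) → Bool
isSYTᵇ T = all incᵇ T ∧ colsAllᵇ T

SYT : List ℕ → List (List (List ℕ))
SYT lam = filterᵇ isSYTᵇ (fillings lam)

rowOf : List (List ℕ) → ℕ → ℕ
rowOf [] i = 0
rowOf (r ∷ rs) i = if any (i ≡ᵇ_) r then 0 else suc (rowOf rs i)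

DesSet : ℕ → List (List ℕ) → List ℕ
DesSet n T = filterᵇ (λ i → rowOf T i <ᵇ rowOf T (suc i)) (map suc (upTo (n ∸ 1)))

diffs : ℕ → ℕ → List ℕ → List ℕ
diffs n prev [] = [ n ∸ prev ]
diffs n prev (a ∷ as) = (a ∸ prev) ∷ diffs n a as

des : ℕ → List (List ℕ) → List ℕ
des n T = diffs n 0 (DesSet n T)

mOf : List ℕ → ℕ
mOf lam = foldr _⊔_ 0 (map (λ T → length (des (sum lam) T)) (SYT lam))

fCoeff : List ℕ → List ℕ → ℕ
fCoeff lam α = length (filter (λ T → ≡-dec _≟_ (des (sum lam) T) α) (SYT lam))

-- Sk_λ(x) represented by its coefficient function: coefficient of x^α.
Sk : List ℕ → List ℕ → ℕ
Sk lam α = fCoeff lam α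

SkAt : List ℕ → ℕ → List ℕ → ℕ
SkAt lam i α = if length α ≡ᵇ i then fCoeff lam α else 0

-- Every row head c below the first row of a standard tableau is smaller than all entries in its row and
-- below it, so c − 1 lies in a higher row and is a descent: ℓ(des T) ≥ ℓ(λ) for every T.  If λ is a hook,
-- each descent i has i + 1 outside the first row, hence at the head of a one-box row, so ℓ(des T) = ℓ(λ)
-- for every T; this gives (ii) and (iii).  If λ is not a hook, put 1, 3, 4, …, λ₁ + 1 in the first row and
-- 2, λ₁ + 2, … in the second: λ₁ + 1 is an extra descent, so ℓ(des T) > ℓ(λ).  Then m(λ) > ℓ(λ), and the
-- coefficient of x^(des T) is positive in Sk_λ but zero in Sk_{λ,ℓ(λ)}.
module Submission where

open import Defs
open import Data.Bool using (Bool; true; false; T; T?; _∧_)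
open import Data.Bool.Properties using (T-∧)
open import Data.Bool.ListAction using (any)
open import Data.Nat using (ℕ; zero; suc; _+_; _∸_; _≤_; _<_; _⊔_; z≤n; s≤s; z<s; s<s; _<ᵇ_; _≡ᵇ_)
open import Data.Nat.Properties
open import Data.Nat.ListAction using (sum)
open import Data.List using (List; []; _∷_; [_]; _++_; map; concat; take; drop; length; upTo; applyUpTo; filterᵇ)
open import Data.List.Properties
  using (foldr-preservesᵇ; foldr-preservesᵒ; ∷-injectiveʳ; map-applyUpTo; length-++-sucʳ; length-map; concat-++;
         take++drop≡id; ≡-dec; filter-none)
open import Data.List.Membership.Propositional using (_∈_; _∉_; find)
open import Data.List.Membership.Propositional.Properties
  using (∈-map⁺; ∈-map⁻; ∈-++⁺ˡ; ∈-++⁺ʳ; ∈-++⁻; ∈-∃++; ∈-concatMap⁺; ∈-concatMap⁻; ∈-filter⁺; ∈-filter⁻)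
open import Data.List.Relation.Unary.Any as Any using (here; there)
open import Data.List.Relation.Unary.Any.Properties using (any⁺; any⁻) renaming (map⁺ to Any-map⁺)
open import Data.List.Relation.Unary.All as All using (All; []; _∷_)
open import Data.List.Relation.Unary.All.Properties
  using (all⁺; all⁻; ++⁻ʳ) renaming (map⁻ to All-map⁻; map⁺ to All-map⁺)
open import Data.List.Relation.Binary.Subset.Propositional using (_⊆_)
open import Relation.Binary.PropositionalEquality.Properties using (setoid)
open import Data.List.Relation.Binary.Permutation.Setoid.Properties (setoid ℕ) using (Unique-resp-↭)
open import Data.List.Relation.Unary.Linked as Linked using (Linked; []; [-]; _∷_)
open import Data.List.Relation.Unary.Unique.Propositional using (Unique; []; _∷_)
import Data.List.Relation.Unary.Unique.Propositional.Properties as Unique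
open import Data.List.Relation.Binary.Permutation.Propositional using (_↭_; refl; prep; swap; trans; ↭-sym; ↭⇒↭ₛ)
open import Data.List.Relation.Binary.Permutation.Propositional.Properties using (∈-resp-↭; ↭-length)
open import Data.Product using (_×_; _,_; proj₁; proj₂; map₂; Σ-syntax)
open import Data.Sum using (inj₁; inj₂; [_,_]′)
open import Data.Empty using (⊥-elim)
open import Function using (_∘_; id; _⇔_; mk⇔; Equivalence)
open import Function.Properties.Equivalence using () renaming (sym to ⇔-sym; trans to ⇔-trans)
open import Relation.Nullary using (¬_; yes; no)
open import Relation.Binary.PropositionalEquality
  using (_≡_; _≢_; refl; sym; cong; cong₂; subst; subst₂; module ≡-Reasoning) renaming (trans to ≡-trans)

interval : ℕ → ℕ → List ℕ
interval s zero    = []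
interval s (suc k) = s ∷ interval (suc s) k

applyUpTo≡interval : ∀ n s (f : ℕ → ℕ) → (∀ i → f i ≡ s + i) → applyUpTo f n ≡ interval s n
applyUpTo≡interval zero    s f f≗s+ = refl
applyUpTo≡interval (suc n) s f f≗s+ =
  cong₂ _∷_ (≡-trans (f≗s+ 0) (+-identityʳ s))
            (applyUpTo≡interval n (suc s) (f ∘ suc) (λ i → ≡-trans (f≗s+ (suc i)) (+-suc s i)))

map-suc-upTo≡interval : ∀ n → map suc (upTo n) ≡ interval 1 n
map-suc-upTo≡interval n = ≡-trans (map-applyUpTo id suc n) (applyUpTo≡interval n 1 suc λ _ → refl)

length-interval : ∀ s k → length (interval s k) ≡ k
length-interval s zero    = refl
length-interval s (suc k) = cong suc (length-interval (suc s) k)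

∈-interval⁻ : ∀ {x} s k → x ∈ interval s k → s ≤ x × x < s + k
∈-interval⁻ s (suc k) (here refl) = ≤-refl , m<m+n s z<s
∈-interval⁻ {x} s (suc k) (there x∈) with s<x , x<s+k ← ∈-interval⁻ (suc s) k x∈ =
  <⇒≤ s<x , subst (x <_) (sym (+-suc s k)) x<s+k

∈-interval⁺ : ∀ {x} s k → s ≤ x → x < s + k → x ∈ interval s k
∈-interval⁺ s zero    s≤x x<s+0 = ⊥-elim (<⇒≱ x<s+0 (subst (_≤ _) (sym (+-identityʳ s)) s≤x))
∈-interval⁺ {x} s (suc k) s≤x x<s+k with s ≟ x
... | yes refl = here refl
... | no  s≢x  = there (∈-interval⁺ (suc s) k (≤∧≢⇒< s≤x s≢x) (subst (x <_) (+-suc s k) x<s+k))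

interval-unique : ∀ s k → Unique (interval s k)
interval-unique s zero    = []
interval-unique s (suc k) =
  All.tabulate (λ x∈ s≡x → <⇒≢ (proj₁ (∈-interval⁻ (suc s) k x∈)) s≡x) ∷ interval-unique (suc s) k

interval-++ : ∀ s k l → interval s (k + l) ≡ interval s k ++ interval (s + k) l
interval-++ s zero    l = cong (λ t → interval t l) (sym (+-identityʳ s))
interval-++ s (suc k) l =
  cong (s ∷_) (≡-trans (interval-++ (suc s) k l) (cong (λ t → interval (suc s) k ++ interval t l) (sym (+-suc s k))))

∈-insertAll : ∀ x us vs → us ++ x ∷ vs ∈ insertAll x (us ++ vs)
∈-insertAll x []       []       = here refl
∈-insertAll x []       (v ∷ vs) = here refl
∈-insertAll x (u ∷ us) vs       = there (∈-map⁺ (u ∷_) (∈-insertAll x us vs))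

∈-perms-refl : ∀ xs → xs ∈ perms xs
∈-perms-refl []       = here refl
∈-perms-refl (x ∷ xs) =
  ∈-concatMap⁺ (insertAll x) (Any.map (λ { refl → ∈-insertAll x [] xs }) (∈-perms-refl xs))

∈-perms-∷ : ∀ {x xs ys zs} → ys ∈ perms xs → zs ∈ insertAll x ys → zs ∈ perms (x ∷ xs)
∈-perms-∷ {x} ys∈ zs∈ = ∈-concatMap⁺ (insertAll x) (Any.map (λ { refl → zs∈ }) ys∈)

insertAll-↭ : ∀ {x ys zs} → zs ∈ insertAll x ys → zs ↭ x ∷ ys
insertAll-↭ {ys = []}     (here refl) = refl
insertAll-↭ {ys = y ∷ ys} (here refl) = refl
insertAll-↭ {x} {y ∷ ys}  (there zs∈) with _ , zs'∈ , refl ← ∈-map⁻ (y ∷_) zs∈ =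
  trans (prep y (insertAll-↭ zs'∈)) (swap y x refl)

perms-↭ : ∀ {xs zs} → zs ∈ perms xs → zs ↭ xs
perms-↭ {[]}     (here refl) = refl
perms-↭ {x ∷ xs} zs∈ with _ , ys∈ , zs∈ys ← find (∈-concatMap⁻ (insertAll x) zs∈) =
  trans (insertAll-↭ zs∈ys) (prep x (perms-↭ ys∈))

Unique-⊆⇒length≤ : ∀ {A : Set} {xs ys : List A} → Unique xs → xs ⊆ ys → length xs ≤ length ys
Unique-⊆⇒length≤ {xs = []}     _            _     = z≤n
Unique-⊆⇒length≤ {xs = x ∷ xs} (x∉xs ∷ !xs) xs⊆ys
  with us , vs , refl ← ∈-∃++ (xs⊆ys (here refl)) =
  subst (suc (length xs) ≤_) (sym (length-++-sucʳ us x vs))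
    (s≤s (Unique-⊆⇒length≤ !xs λ y∈xs →
            ∈-++-∷⁻ us (xs⊆ys (there y∈xs)) λ y≡x → All.lookup x∉xs y∈xs (sym y≡x)))
  where
  ∈-++-∷⁻ : ∀ {y} us {vs} → y ∈ us ++ x ∷ vs → y ≢ x → y ∈ us ++ vs
  ∈-++-∷⁻ []       (here y≡x) y≢x = ⊥-elim (y≢x y≡x)
  ∈-++-∷⁻ []       (there y∈) y≢x = y∈
  ∈-++-∷⁻ (u ∷ us) (here y≡u) y≢x = here y≡u
  ∈-++-∷⁻ (u ∷ us) (there y∈) y≢x = there (∈-++-∷⁻ us y∈ y≢x)

Unique-++⁻ʳ : ∀ {A : Set} (xs : List A) {ys} → Unique (xs ++ ys) → Unique ys
Unique-++⁻ʳ []       !ys        = !ys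
Unique-++⁻ʳ (x ∷ xs) (_ ∷ !xys) = Unique-++⁻ʳ xs !xys

Unique-++⇒disjoint : ∀ {A : Set} (xs : List A) {ys x} → Unique (xs ++ ys) → x ∈ xs → x ∉ ys
Unique-++⇒disjoint (x ∷ xs) (x∉ ∷ _)    (here refl) x∈ys = All.lookup x∉ (∈-++⁺ʳ xs x∈ys) refl
Unique-++⇒disjoint (_ ∷ xs) (_ ∷ !xys) (there x∈)  x∈ys = Unique-++⇒disjoint xs !xys x∈ x∈ys

Linked-++⁻ʳ : ∀ {A : Set} {_~_ : A → A → Set} xs {ys} → Linked _~_ (xs ++ ys) → Linked _~_ ys
Linked-++⁻ʳ []       lnk = lnk
Linked-++⁻ʳ (x ∷ xs) lnk = Linked-++⁻ʳ xs (Linked.tail lnk)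

T-∧⁺ : ∀ {a b} → T a → T b → T (a ∧ b)
T-∧⁺ p q = Equivalence.from T-∧ (p , q)

Tableau : Set
Tableau = List (List ℕ)

IncreasingRow : List ℕ → Set
IncreasingRow r = T (incᵇ r)

ColumnStrict : List ℕ → List ℕ → Set
ColumnStrict r r' = T (colsᵇ r r')

T-colsAllᵇ⁻ : ∀ t → T (colsAllᵇ t) → Linked ColumnStrict t
T-colsAllᵇ⁻ []           _ = []
T-colsAllᵇ⁻ (r ∷ [])     _ = [-]
T-colsAllᵇ⁻ (r ∷ r' ∷ t) p =
  proj₁ (Equivalence.to T-∧ p) ∷ T-colsAllᵇ⁻ (r' ∷ t) (proj₂ (Equivalence.to T-∧ p))

T-colsAllᵇ⁺ : ∀ {t} → Linked ColumnStrict t → T (colsAllᵇ t)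
T-colsAllᵇ⁺ []           = _
T-colsAllᵇ⁺ [-]          = _
T-colsAllᵇ⁺ (r◁r' ∷ lnk) = T-∧⁺ r◁r' (T-colsAllᵇ⁺ lnk)

T-isSYTᵇ⁻ : ∀ t → T (isSYTᵇ t) → All IncreasingRow t × Linked ColumnStrict t
T-isSYTᵇ⁻ t p with rows , cols ← Equivalence.to T-∧ p = all⁺ incᵇ t rows , T-colsAllᵇ⁻ t cols

T-isSYTᵇ⁺ : ∀ {t} → All IncreasingRow t → Linked ColumnStrict t → T (isSYTᵇ t)
T-isSYTᵇ⁺ rows cols = T-∧⁺ (all⁻ incᵇ rows) (T-colsAllᵇ⁺ cols)

take-length-++ : ∀ {A : Set} (xs ys : List A) → take (length xs) (xs ++ ys) ≡ xs
take-length-++ []       ys = refl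
take-length-++ (x ∷ xs) ys = cong (x ∷_) (take-length-++ xs ys)

drop-length-++ : ∀ {A : Set} (xs ys : List A) → drop (length xs) (xs ++ ys) ≡ ys
drop-length-++ []       ys = refl
drop-length-++ (x ∷ xs) ys = drop-length-++ xs ys

chunk-concat : ∀ (t : Tableau) → chunk (map length t) (concat t) ≡ t
chunk-concat []      = refl
chunk-concat (r ∷ t) = cong₂ _∷_ (take-length-++ r (concat t))
  (≡-trans (cong (chunk (map length t)) (drop-length-++ r (concat t))) (chunk-concat t))

length-take-drop : ∀ k m (w : List ℕ) → length w ≡ k + m → length (take k w) ≡ k × length (drop k w) ≡ m
length-take-drop zero    m w       |w| = refl , |w|
length-take-drop (suc k) m (x ∷ w) |w| with |t| , |d| ← length-take-drop k m w (suc-injective |w|) = cong suc |t| , |d|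

concat-chunk : ∀ lam (w : List ℕ) → length w ≡ sum lam → concat (chunk lam w) ≡ w
concat-chunk []        []  _   = refl
concat-chunk (k ∷ lam) w   |w| =
  ≡-trans (cong (take k w ++_) (concat-chunk lam (drop k w) (proj₂ (length-take-drop k (sum lam) w |w|))))
          (take++drop≡id k w)

map-length-chunk : ∀ lam (w : List ℕ) → length w ≡ sum lam → map length (chunk lam w) ≡ lam
map-length-chunk []        w _   = refl
map-length-chunk (k ∷ lam) w |w| with |t| , |d| ← length-take-drop k (sum lam) w |w| =
  cong₂ _∷_ |t| (map-length-chunk lam (drop k w) |d|)

record IsStandard (lam : List ℕ) (t : Tableau) : Set where
  field
    shape              : map length t ≡ lam
    entries-unique     : Unique (concat t)
    entries-bounded    : ∀ {x} → x ∈ concat t → 1 ≤ x × x ≤ sum lam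
    entries-complete   : ∀ {x} → 1 ≤ x → x ≤ sum lam → x ∈ concat t
    rows-increasing    : All IncreasingRow t
    columns-increasing : Linked ColumnStrict t

SYT⇒IsStandard : ∀ {lam t} → t ∈ SYT lam → IsStandard lam t
SYT⇒IsStandard {lam} t∈
  with t∈fillings , syt ← ∈-filter⁻ (T? ∘ isSYTᵇ) {xs = fillings lam} t∈
  with w , w∈ , refl ← ∈-map⁻ (chunk lam) t∈fillings = record
  { shape              = map-length-chunk lam w |w|
  ; entries-unique     = subst Unique (sym concat≡w) (Unique-resp-↭ (↭⇒↭ₛ (↭-sym w↭)) (interval-unique 1 n))
  ; entries-bounded    = λ x∈ → map₂ ≤-pred (∈-interval⁻ 1 n (∈-resp-↭ w↭ (subst (_ ∈_) concat≡w x∈)))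
  ; entries-complete   = λ 1≤x x≤n →
      subst (_ ∈_) (sym concat≡w) (∈-resp-↭ (↭-sym w↭) (∈-interval⁺ 1 n 1≤x (s≤s x≤n)))
  ; rows-increasing    = proj₁ (T-isSYTᵇ⁻ _ syt)
  ; columns-increasing = proj₂ (T-isSYTᵇ⁻ _ syt)
  }
  where
  n : ℕ
  n = sum lam
  w↭ : w ↭ interval 1 n
  w↭ = subst (w ↭_) (map-suc-upTo≡interval n) (perms-↭ w∈)
  |w| : length w ≡ n
  |w| = ≡-trans (↭-length w↭) (length-interval 1 n)
  concat≡w : concat (chunk lam w) ≡ w
  concat≡w = concat-chunk lam w |w|

∈-SYT : ∀ lam t → map length t ≡ lam → concat t ∈ perms (interval 1 (sum lam)) →
        All IncreasingRow t → Linked ColumnStrict t → t ∈ SYT lam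
∈-SYT lam t shape w∈ rows cols = ∈-filter⁺ (T? ∘ isSYTᵇ) {xs = fillings lam}
  (subst (_∈ fillings lam) (≡-trans (cong (λ μ → chunk μ (concat t)) (sym shape)) (chunk-concat t))
    (∈-map⁺ (chunk lam) (subst (λ ws → concat t ∈ perms ws) (sym (map-suc-upTo≡interval (sum lam))) w∈)))
  (T-isSYTᵇ⁺ rows cols)

∈⇒T-any-≡ᵇ : ∀ {x R} → x ∈ R → T (any (x ≡ᵇ_) R)
∈⇒T-any-≡ᵇ {x} x∈R = any⁺ (x ≡ᵇ_) (Any.map (≡⇒≡ᵇ x _) x∈R)

T-any-≡ᵇ⇒∈ : ∀ {x} R → T (any (x ≡ᵇ_) R) → x ∈ R
T-any-≡ᵇ⇒∈ {x} R p = Any.map (≡ᵇ⇒≡ x _) (any⁻ (x ≡ᵇ_) R p)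

rowOf-∷-∈ : ∀ {x R} rs → x ∈ R → rowOf (R ∷ rs) x ≡ 0
rowOf-∷-∈ {x} {R} rs x∈R with any (x ≡ᵇ_) R | ∈⇒T-any-≡ᵇ x∈R
... | true | _ = refl

rowOf-∷-∉ : ∀ {x R} rs → x ∉ R → rowOf (R ∷ rs) x ≡ suc (rowOf rs x)
rowOf-∷-∉ {x} {R} rs x∉R with any (x ≡ᵇ_) R in eq
... | false = refl
... | true  = ⊥-elim (x∉R (T-any-≡ᵇ⇒∈ R (subst T (sym eq) _)))

rowOf-++-∉ : ∀ {x} pre rs → x ∉ concat pre → rowOf (pre ++ rs) x ≡ length pre + rowOf rs x
rowOf-++-∉ []        rs x∉ = refl
rowOf-++-∉ (R ∷ pre) rs x∉ =
  ≡-trans (rowOf-∷-∉ {R = R} (pre ++ rs) (x∉ ∘ ∈-++⁺ˡ)) (cong suc (rowOf-++-∉ pre rs (x∉ ∘ ∈-++⁺ʳ R)))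

rowOf-++-∈ : ∀ {x} pre rs → x ∈ concat pre → rowOf (pre ++ rs) x < length pre
rowOf-++-∈ {x} (R ∷ pre) rs x∈ with any (x ≡ᵇ_) R in eq
... | true  = s≤s z≤n
... | false with ∈-++⁻ R x∈
...   | inj₁ x∈R   = ⊥-elim (subst T eq (∈⇒T-any-≡ᵇ x∈R))
...   | inj₂ x∈pre = s≤s (rowOf-++-∈ pre rs x∈pre)

∈-DesSet⁺ : ∀ n t {i} → 1 ≤ i → suc i ≤ n → rowOf t i < rowOf t (suc i) → i ∈ DesSet n t
∈-DesSet⁺ (suc m) t {i} 1≤i i<n descent = ∈-filter⁺ (T? ∘ λ j → rowOf t j <ᵇ rowOf t (suc j))
  (subst (i ∈_) (sym (map-suc-upTo≡interval m)) (∈-interval⁺ 1 m 1≤i i<n))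
  (<⇒<ᵇ descent)

∈-DesSet⁻ : ∀ n t {i} → i ∈ DesSet n t → 1 ≤ i × suc i ≤ n × rowOf t i < rowOf t (suc i)
∈-DesSet⁻ n t {i} i∈ with i∈range , descent ← ∈-filter⁻ (T? ∘ λ j → rowOf t j <ᵇ rowOf t (suc j)) i∈
  with 1≤i , i<n ← ∈-interval⁻ 1 (n ∸ 1) (subst (i ∈_) (map-suc-upTo≡interval (n ∸ 1)) i∈range) =
  1≤i , <∸1⇒suc≤ n 1≤i i<n , <ᵇ⇒< _ _ descent
  where
  <∸1⇒suc≤ : ∀ n {i} → 1 ≤ i → i < suc (n ∸ 1) → suc i ≤ n
  <∸1⇒suc≤ zero    (s≤s z≤n) (s≤s ())
  <∸1⇒suc≤ (suc m) _         i<n      = i<n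

NonEmpty : List ℕ → Set
NonEmpty r = 1 ≤ length r

IncreasingRow-head< : ∀ {c R y} → IncreasingRow (c ∷ R) → y ∈ R → c < y
IncreasingRow-head< {c} {d ∷ R} inc (here refl) = <ᵇ⇒< c d (proj₁ (Equivalence.to T-∧ inc))
IncreasingRow-head< {c} {d ∷ R} inc (there y∈) =
  <-trans (<ᵇ⇒< c d (proj₁ (Equivalence.to T-∧ inc))) (IncreasingRow-head< (proj₂ (Equivalence.to T-∧ inc)) y∈)

ColumnStrict-head< : ∀ {c R d R'} → ColumnStrict (c ∷ R) (d ∷ R') → c < d
ColumnStrict-head< {c} {d = d} c◁d = <ᵇ⇒< c d (proj₁ (Equivalence.to T-∧ c◁d))

head<rest  : ∀ {c R y} rows → All IncreasingRow ((c ∷ R) ∷ rows) → Linked ColumnStrict ((c ∷ R) ∷ rows) →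
             All NonEmpty rows → y ∈ R ++ concat rows → c < y
head<lower : ∀ {c R y} rows → All IncreasingRow rows → Linked ColumnStrict ((c ∷ R) ∷ rows) →
             All NonEmpty rows → y ∈ concat rows → c < y

head<rest {R = R} rows (inc ∷ incs) cols nes y∈ with ∈-++⁻ R y∈
... | inj₁ y∈R    = IncreasingRow-head< inc y∈R
... | inj₂ y∈rows = head<lower rows incs cols nes y∈rows

head<lower ([] ∷ rows)      _    _            (() ∷ _)
head<lower {R = R₀} ((d ∷ R) ∷ rows) incs (c◁d ∷ cols) (_ ∷ nes) (here refl) =
  ColumnStrict-head< {R = R₀} {R' = R} c◁d
head<lower {R = R₀} ((d ∷ R) ∷ rows) incs (c◁d ∷ cols) (_ ∷ nes) (there y∈) =
  <-trans (ColumnStrict-head< {R = R₀} {R' = R} c◁d) (head<rest rows incs cols nes y∈)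

descent-across : ∀ {lam x} pre post → IsStandard lam (pre ++ post) →
                 x ∈ concat pre → suc x ∈ concat post → x ∈ DesSet (sum lam) (pre ++ post)
descent-across {x = x} pre post std x∈pre sx∈post =
  ∈-DesSet⁺ _ (pre ++ post) (proj₁ (entries-bounded x∈t)) (proj₂ (entries-bounded sx∈t)) (begin-strict
    rowOf (pre ++ post) x           <⟨ rowOf-++-∈ pre post x∈pre ⟩
    length pre                      ≤⟨ m≤m+n (length pre) _ ⟩
    length pre + rowOf post (suc x) ≡⟨ rowOf-++-∉ pre post sx∉pre ⟨
    rowOf (pre ++ post) (suc x)     ∎)
  where
  open IsStandard std
  open ≤-Reasoning
  split : concat pre ++ concat post ≡ concat (pre ++ post)
  split = concat-++ pre post
  x∈t : x ∈ concat (pre ++ post)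
  x∈t = subst (x ∈_) split (∈-++⁺ˡ x∈pre)
  sx∈t : suc x ∈ concat (pre ++ post)
  sx∈t = subst (suc x ∈_) split (∈-++⁺ʳ (concat pre) sx∈post)
  sx∉pre : suc x ∉ concat pre
  sx∉pre sx∈pre = Unique-++⇒disjoint (concat pre) (subst Unique (sym split) entries-unique) sx∈pre sx∈post

∈-concat-++-∷ : ∀ (pre : Tableau) c R post → c ∈ concat (pre ++ (c ∷ R) ∷ post)
∈-concat-++-∷ pre c R post = subst (c ∈_) (concat-++ pre ((c ∷ R) ∷ post)) (∈-++⁺ʳ (concat pre) (here refl))

-- 0 is a junk value: the rows of a tableau of partition shape are nonempty.
rowHead : List ℕ → ℕ
rowHead []      = 0
rowHead (c ∷ _) = c

rowHead∈descentTops : ∀ {lam} pre R post → pre ≢ [] → IsStandard lam (pre ++ R ∷ post) →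
                  All NonEmpty (pre ++ R ∷ post) → rowHead R ∈ map suc (DesSet (sum lam) (pre ++ R ∷ post))
rowHead∈descentTops []              R            post pre≢[] = ⊥-elim (pre≢[] refl)
rowHead∈descentTops ([] ∷ pre)      R            post _ _ (() ∷ _)
rowHead∈descentTops (r ∷ pre)       []           post _ _ nes with () ← All.head (++⁻ʳ (r ∷ pre) nes)
rowHead∈descentTops (r ∷ pre)       (zero ∷ R)   post _ std _ =
  ⊥-elim (1+n≰n {0} (proj₁ (IsStandard.entries-bounded std (∈-concat-++-∷ (r ∷ pre) 0 R post))))
rowHead∈descentTops ((p ∷ P) ∷ pre) (suc i ∷ R) post _ std (_ ∷ nes) =
  ∈-map⁺ suc (descent-across upper lower std i∈upper (here refl))
  where
  open IsStandard std
  upper lower : Tableau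
  upper = (p ∷ P) ∷ pre
  lower = (suc i ∷ R) ∷ post
  split : concat upper ++ concat lower ≡ concat (upper ++ lower)
  split = concat-++ upper lower
  p<1+i : p < suc i
  p<1+i = head<lower (pre ++ lower) (All.tail rows-increasing) columns-increasing nes (∈-concat-++-∷ pre (suc i) R post)
  i∈t : i ∈ concat (upper ++ lower)
  i∈t = entries-complete (≤-trans (proj₁ (entries-bounded (here refl))) (≤-pred p<1+i))
                         (<⇒≤ (proj₂ (entries-bounded (∈-concat-++-∷ upper (suc i) R post))))
  i∈upper : i ∈ concat upper
  i∈upper with ∈-++⁻ (concat upper) (subst (i ∈_) (sym split) i∈t)
  ... | inj₁ i∈upper         = i∈upper
  ... | inj₂ (here i≡1+i)    = ⊥-elim (<-irrefl i≡1+i (n<1+n i))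
  ... | inj₂ (there i∈lower) = ⊥-elim (<-asym (n<1+n i)
          (head<rest post (++⁻ʳ upper rows-increasing) (Linked-++⁻ʳ upper columns-increasing)
                     (All.tail (++⁻ʳ pre nes)) i∈lower))

rowHead∈concat : ∀ {y} t → All NonEmpty t → y ∈ map rowHead t → y ∈ concat t
rowHead∈concat ([] ∷ t)      (() ∷ _)
rowHead∈concat ((c ∷ R) ∷ t) _         (here refl) = here refl
rowHead∈concat ((c ∷ R) ∷ t) (_ ∷ nes) (there y∈)  = ∈-++⁺ʳ (c ∷ R) (rowHead∈concat t nes y∈)

rowHeads-unique : ∀ t → All NonEmpty t → Unique (concat t) → Unique (map rowHead t)
rowHeads-unique []            _         _            = []
rowHeads-unique ([] ∷ t)      (() ∷ _)
rowHeads-unique ((c ∷ R) ∷ t) (_ ∷ nes) (c∉ ∷ !rest) =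
  All.tabulate (λ y∈ → All.lookup c∉ (∈-++⁺ʳ R (rowHead∈concat t nes y∈)))
  ∷ rowHeads-unique t nes (Unique-++⁻ʳ R !rest)

lowerRowHeads⊆descentTops : ∀ {lam} r rows → IsStandard lam (r ∷ rows) → All NonEmpty (r ∷ rows) →
                            map rowHead rows ⊆ map suc (DesSet (sum lam) (r ∷ rows))
lowerRowHeads⊆descentTops r rows std nes y∈
  with R , R∈ , refl ← ∈-map⁻ rowHead y∈
  with us , vs , refl ← ∈-∃++ R∈ = rowHead∈descentTops (r ∷ us) R vs (λ ()) std nes

length-rows≤descents : ∀ {lam} r rows → IsStandard lam (r ∷ rows) → All NonEmpty (r ∷ rows) →
                       length rows ≤ length (DesSet (sum lam) (r ∷ rows))
length-rows≤descents {lam} r rows std nes = begin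
  length rows                                    ≡⟨ length-map rowHead rows ⟨
  length (map rowHead rows)                      ≤⟨ Unique-⊆⇒length≤ heads-unique (lowerRowHeads⊆descentTops r rows std nes) ⟩
  length (map suc (DesSet (sum lam) (r ∷ rows))) ≡⟨ length-map suc (DesSet (sum lam) (r ∷ rows)) ⟩
  length (DesSet (sum lam) (r ∷ rows))           ∎
  where
  open ≤-Reasoning
  heads-unique : Unique (map rowHead rows)
  heads-unique = rowHeads-unique rows (All.tail nes) (Unique-++⁻ʳ r (IsStandard.entries-unique std))

DesSet-unique : ∀ n t → Unique (DesSet n t)
DesSet-unique n t =
  Unique.filter⁺ (T? ∘ λ j → rowOf t j <ᵇ rowOf t (suc j)) (Unique.map⁺ suc-injective (Unique.upTo⁺ (n ∸ 1)))

Singleton : List ℕ → Set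
Singleton r = length r ≡ 1

concat-singletons⊆rowHeads : ∀ rows → All Singleton rows → concat rows ⊆ map rowHead rows
concat-singletons⊆rowHeads ((c ∷ []) ∷ rows) (_ ∷ ones) (here refl) = here refl
concat-singletons⊆rowHeads ((c ∷ []) ∷ rows) (_ ∷ ones) (there y∈) =
  there (concat-singletons⊆rowHeads rows ones y∈)

descentTops⊆lowerRowHeads : ∀ {lam} r rows → IsStandard lam (r ∷ rows) → All Singleton rows →
                            map suc (DesSet (sum lam) (r ∷ rows)) ⊆ map rowHead rows
descentTops⊆lowerRowHeads {lam} r rows std ones y∈
  with i , i∈ , refl ← ∈-map⁻ suc y∈
  with 1≤i , i<n , descent ← ∈-DesSet⁻ (sum lam) (r ∷ rows) i∈
  with ∈-++⁻ r (IsStandard.entries-complete std (s≤s z≤n) i<n)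
... | inj₁ 1+i∈r    = ⊥-elim (n≮0 (subst (rowOf (r ∷ rows) i <_) (rowOf-∷-∈ rows 1+i∈r) descent))
... | inj₂ 1+i∈rows = concat-singletons⊆rowHeads rows ones 1+i∈rows

descents≤length-rows : ∀ {lam} r rows → IsStandard lam (r ∷ rows) → All Singleton rows →
                       length (DesSet (sum lam) (r ∷ rows)) ≤ length rows
descents≤length-rows {lam} r rows std ones = begin
  length (DesSet (sum lam) (r ∷ rows))           ≡⟨ length-map suc (DesSet (sum lam) (r ∷ rows)) ⟨
  length (map suc (DesSet (sum lam) (r ∷ rows))) ≤⟨ Unique-⊆⇒length≤ tops-unique (descentTops⊆lowerRowHeads r rows std ones) ⟩
  length (map rowHead rows)                      ≡⟨ length-map rowHead rows ⟩
  length rows                                    ∎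
  where
  open ≤-Reasoning
  tops-unique : Unique (map suc (DesSet (sum lam) (r ∷ rows)))
  tops-unique = Unique.map⁺ suc-injective (DesSet-unique (sum lam) (r ∷ rows))

length-diffs : ∀ n prev D → length (diffs n prev D) ≡ suc (length D)
length-diffs n prev []      = refl
length-diffs n prev (a ∷ D) = cong suc (length-diffs n a D)

length-des : ∀ n t → length (des n t) ≡ suc (length (DesSet n t))
length-des n t = length-diffs n 0 (DesSet n t)

∸-split : ∀ {p s n} → p ≤ s → s ≤ n → (s ∸ p) + (n ∸ s) ≡ n ∸ p
∸-split {p} {s} {n} p≤s s≤n = begin
  (s ∸ p) + (n ∸ s) ≡⟨ +-comm (s ∸ p) (n ∸ s) ⟩
  (n ∸ s) + (s ∸ p) ≡⟨ +-∸-assoc (n ∸ s) p≤s ⟨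
  (n ∸ s) + s ∸ p   ≡⟨ cong (_∸ p) (m∸n+n≡m s≤n) ⟩
  n ∸ p             ∎
  where open ≡-Reasoning

diffs-isComposition : ∀ (P : ℕ → Bool) n k s prev → prev < s → s + k ≤ n →
                      IsComposition (n ∸ prev) (diffs n prev (filterᵇ P (interval s k)))
diffs-isComposition P n zero    s prev prev<s s≤n =
  m<n⇒0<n∸m (<-≤-trans prev<s (≤-trans (m≤m+n s 0) s≤n)) ∷ [] , +-identityʳ _
diffs-isComposition P n (suc k) s prev prev<s s+k≤n with P s
... | true with positive , total ← diffs-isComposition P n k (suc s) s (n<1+n s) (subst (_≤ n) (+-suc s k) s+k≤n) =
  m<n⇒0<n∸m prev<s ∷ positive ,
  ≡-trans (cong ((s ∸ prev) +_) total) (∸-split (<⇒≤ prev<s) (≤-trans (m≤m+n s (suc k)) s+k≤n))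
... | false = diffs-isComposition P n k (suc s) prev (<-trans prev<s (n<1+n s)) (subst (_≤ n) (+-suc s k) s+k≤n)

des-isComposition : ∀ n t → 1 ≤ n → IsComposition n (des n t)
des-isComposition (suc m) t _ =
  subst (λ ds → IsComposition (suc m) (diffs (suc m) 0 (filterᵇ (λ i → rowOf t i <ᵇ rowOf t (suc i)) ds)))
        (sym (map-suc-upTo≡interval m))
        (diffs-isComposition _ (suc m) m 1 0 (s≤s z≤n) ≤-refl)

superstandard : ℕ → List ℕ → Tableau
superstandard s []       = []
superstandard s (k ∷ ks) = interval s k ∷ superstandard (s + k) ks

concat-superstandard : ∀ s μ → concat (superstandard s μ) ≡ interval s (sum μ)
concat-superstandard s []       = refl
concat-superstandard s (k ∷ ks) =
  ≡-trans (cong (interval s k ++_) (concat-superstandard (s + k) ks)) (sym (interval-++ s k (sum ks)))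

map-length-superstandard : ∀ s μ → map length (superstandard s μ) ≡ μ
map-length-superstandard s []       = refl
map-length-superstandard s (k ∷ ks) = cong₂ _∷_ (length-interval s k) (map-length-superstandard (s + k) ks)

IncreasingRow-∷-interval : ∀ x s k → x < s → IncreasingRow (x ∷ interval s k)
IncreasingRow-∷-interval x s zero    x<s = _
IncreasingRow-∷-interval x s (suc k) x<s = T-∧⁺ (<⇒<ᵇ x<s) (IncreasingRow-∷-interval s (suc s) k (n<1+n s))

IncreasingRow-interval : ∀ s k → IncreasingRow (interval s k)
IncreasingRow-interval s zero    = _
IncreasingRow-interval s (suc k) = IncreasingRow-∷-interval s (suc s) k (n<1+n s)

ColumnStrict-interval : ∀ s k t l → l ≤ k → s < t → ColumnStrict (interval s k) (interval t l)
ColumnStrict-interval s zero    t zero    _         _   = _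
ColumnStrict-interval s (suc k) t zero    _         _   = _
ColumnStrict-interval s (suc k) t (suc l) (s≤s l≤k) s<t =
  T-∧⁺ (<⇒<ᵇ s<t) (ColumnStrict-interval (suc s) k (suc t) l l≤k (s<s s<t))

rows-superstandard : ∀ s μ → All IncreasingRow (superstandard s μ)
rows-superstandard s []       = []
rows-superstandard s (k ∷ ks) = IncreasingRow-interval s k ∷ rows-superstandard (s + k) ks

columns-superstandard : ∀ s μ → All (1 ≤_) μ → Linked (λ a b → b ≤ a) μ →
                        Linked ColumnStrict (superstandard s μ)
columns-superstandard s []           _              _             = []
columns-superstandard s (k ∷ [])     _              _             = [-]
columns-superstandard s (k ∷ k' ∷ μ) (1≤k ∷ 1≤μ) (k'≤k ∷ ≥μ) =
  ColumnStrict-interval s k (s + k) k' k'≤k (m<m+n s 1≤k) ∷ columns-superstandard (s + k) (k' ∷ μ) 1≤μ ≥μ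

superstandard∈SYT : ∀ {lam} → IsPartition lam → superstandard 1 lam ∈ SYT lam
superstandard∈SYT {lam} (1≤lam , ≥lam) =
  ∈-SYT lam (superstandard 1 lam) (map-length-superstandard 1 lam)
    (subst (_∈ perms (interval 1 (sum lam))) (sym (concat-superstandard 1 lam)) (∈-perms-refl _))
    (rows-superstandard 1 lam) (columns-superstandard 1 lam 1≤lam ≥lam)

first-row-descent : ∀ {lam x} r rows → IsStandard lam (r ∷ rows) → All NonEmpty (r ∷ rows) →
                    x ∈ r → suc x ∈ concat rows → suc x ∉ map rowHead rows →
                    suc (length rows) ≤ length (DesSet (sum lam) (r ∷ rows))
first-row-descent {lam} {x} r rows std nes x∈r 1+x∈rows 1+x∉heads = begin
  suc (length rows)                              ≡⟨ cong suc (length-map rowHead rows) ⟨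
  length (suc x ∷ map rowHead rows)              ≤⟨ Unique-⊆⇒length≤ tops-unique tops⊆ ⟩
  length (map suc (DesSet (sum lam) (r ∷ rows))) ≡⟨ length-map suc (DesSet (sum lam) (r ∷ rows)) ⟩
  length (DesSet (sum lam) (r ∷ rows))           ∎
  where
  open ≤-Reasoning
  tops-unique : Unique (suc x ∷ map rowHead rows)
  tops-unique = All.tabulate (λ y∈ 1+x≡y → 1+x∉heads (subst (_∈ _) (sym 1+x≡y) y∈))
              ∷ rowHeads-unique rows (All.tail nes) (Unique-++⁻ʳ r (IsStandard.entries-unique std))
  tops⊆ : suc x ∷ map rowHead rows ⊆ map suc (DesSet (sum lam) (r ∷ rows))
  tops⊆ (here refl) = ∈-map⁺ suc (descent-across [ r ] rows std (∈-++⁺ˡ x∈r) 1+x∈rows)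
  tops⊆ (there y∈)  = lowerRowHeads⊆descentTops r rows std nes y∈

rowHeads-superstandard-≥ : ∀ {y} s μ → All (1 ≤_) μ → y ∈ map rowHead (superstandard s μ) → s ≤ y
rowHeads-superstandard-≥ s (zero ∷ μ)  (() ∷ _)    _
rowHeads-superstandard-≥ s (suc k ∷ μ) _           (here refl) = ≤-refl
rowHeads-superstandard-≥ s (suc k ∷ μ) (_ ∷ 1≤μ) (there y∈)  =
  ≤-trans (m≤m+n s (suc k)) (rowHeads-superstandard-≥ (s + suc k) μ 1≤μ y∈)

length-shape : ∀ {t : Tableau} {lam} → map length t ≡ lam → length t ≡ length lam
length-shape {t} shape = ≡-trans (sym (length-map length t)) (cong length shape)

All-shape : ∀ {P : ℕ → Set} {t : Tableau} {lam} → map length t ≡ lam → All P lam → All (P ∘ length) t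
All-shape refl = All-map⁻

module NonHook {a b : ℕ} {μ : List ℕ} (b≤a : b ≤ a) (1≤μ : All (1 ≤_) μ)
               (≥μ : Linked (λ m n → n ≤ m) (2 + b ∷ μ)) where

  shape : List ℕ
  shape = 2 + a ∷ 2 + b ∷ μ

  start : ℕ
  start = 4 + a + suc b

  firstRow secondRow : List ℕ
  firstRow  = 1 ∷ interval 3 (suc a)
  secondRow = 2 ∷ interval (4 + a) (suc b)

  lowerRows tableau : Tableau
  lowerRows = secondRow ∷ superstandard start μ
  tableau   = firstRow ∷ lowerRows

  tableau-shape : map length tableau ≡ shape
  tableau-shape = cong₂ _∷_ (cong suc (length-interval 3 (suc a)))
                    (cong₂ _∷_ (cong suc (length-interval (4 + a) (suc b))) (map-length-superstandard start μ))

  tableau-entries : concat tableau ∈ perms (interval 1 (sum shape))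
  tableau-entries =
    ∈-perms-∷ {xs = 2 ∷ interval 3 rest}
      (∈-perms-∷ {xs = interval 3 rest} (subst (_∈ perms (interval 3 rest)) split (∈-perms-refl _))
                                        (∈-insertAll 2 us vs))
      (∈-insertAll 1 [] (us ++ 2 ∷ vs))
    where
    rest : ℕ
    rest = a + (2 + b + sum μ)
    us vs : List ℕ
    us = interval 3 (suc a)
    vs = interval (4 + a) (suc b) ++ concat (superstandard start μ)
    split : interval 3 rest ≡ us ++ vs
    split = begin
      interval 3 rest
        ≡⟨ cong (interval 3) (+-suc a (suc b + sum μ)) ⟩
      interval 3 (suc a + (suc b + sum μ))
        ≡⟨ interval-++ 3 (suc a) (suc b + sum μ) ⟩
      us ++ interval (4 + a) (suc b + sum μ)
        ≡⟨ cong (us ++_) (interval-++ (4 + a) (suc b) (sum μ)) ⟩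
      us ++ (interval (4 + a) (suc b) ++ interval start (sum μ))
        ≡⟨ cong (λ ws → us ++ (interval (4 + a) (suc b) ++ ws)) (concat-superstandard start μ) ⟨
      us ++ vs ∎
      where open ≡-Reasoning

  tableau-rows : All IncreasingRow tableau
  tableau-rows = IncreasingRow-∷-interval 1 3 (suc a) (s≤s (s≤s z≤n))
               ∷ IncreasingRow-∷-interval 2 (4 + a) (suc b) (s≤s (s≤s (s≤s z≤n)))
               ∷ rows-superstandard start μ

  lower-columns : ∀ ν → All (1 ≤_) ν → Linked (λ m n → n ≤ m) (2 + b ∷ ν) →
                  Linked ColumnStrict (secondRow ∷ superstandard start ν)
  lower-columns []          _         _               = [-]
  lower-columns (suc k ∷ ν) (_ ∷ 1≤ν) (s≤s k≤1+b ∷ ≥ν) =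
    T-∧⁺ (<⇒<ᵇ {2} {start} (s≤s (s≤s (s≤s z≤n))))
         (ColumnStrict-interval (4 + a) (suc b) (suc start) k k≤1+b (s≤s (m≤m+n (4 + a) (suc b))))
    ∷ columns-superstandard start (suc k ∷ ν) (s≤s z≤n ∷ 1≤ν) ≥ν

  tableau-columns : Linked ColumnStrict tableau
  tableau-columns = T-∧⁺ {1 <ᵇ 2} _ (ColumnStrict-interval 3 (suc a) (4 + a) (suc b) (s≤s b≤a) (m≤m+n 4 a))
                  ∷ lower-columns μ 1≤μ ≥μ

  tableau∈SYT : tableau ∈ SYT shape
  tableau∈SYT = ∈-SYT shape tableau tableau-shape tableau-entries tableau-rows tableau-columns

  tableau-longDescent : length shape < length (des (sum shape) tableau)
  tableau-longDescent =
    subst₂ _<_ (cong (2 +_) (length-shape (map-length-superstandard start μ))) (sym (length-des (sum shape) tableau))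
      (s≤s (first-row-descent firstRow lowerRows (SYT⇒IsStandard {shape} tableau∈SYT)
              (All-shape tableau-shape (s≤s z≤n ∷ s≤s z≤n ∷ 1≤μ))
              (there (∈-interval⁺ 3 (suc a) (m≤m+n 3 a) (n<1+n (3 + a)))) (there (here refl)) 4+a∉heads))
    where
    4+a∉heads : 4 + a ∉ map rowHead lowerRows
    4+a∉heads (there y∈) = <⇒≱ (m<m+n (4 + a) (s≤s z≤n)) (rowHeads-superstandard-≥ start μ 1≤μ y∈)

nonHook-longDescent : ∀ {lam} → IsPartition lam → ¬ IsHook lam →
                      Σ[ t ∈ Tableau ] t ∈ SYT lam × length lam < length (des (sum lam) t)
nonHook-longDescent {[]}               _ ¬hook = ⊥-elim (¬hook z≤n)
nonHook-longDescent {_ ∷ []}           _ ¬hook = ⊥-elim (¬hook z≤n)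
nonHook-longDescent {_ ∷ zero ∷ _}     (_ ∷ () ∷ _ , _)
nonHook-longDescent {_ ∷ suc zero ∷ _} _ ¬hook = ⊥-elim (¬hook ≤-refl)
nonHook-longDescent {suc (suc a) ∷ suc (suc b) ∷ μ} (_ ∷ _ ∷ 1≤μ , s≤s (s≤s b≤a) ∷ ≥μ) _ =
  tableau , tableau∈SYT , tableau-longDescent
  where open NonHook b≤a 1≤μ ≥μ

≤-mOf : ∀ {lam t} → t ∈ SYT lam → length (des (sum lam) t) ≤ mOf lam
≤-mOf {lam} {t} t∈ =
  foldr-preservesᵒ {P = length (des (sum lam) t) ≤_} {f = _⊔_} (λ x y → [ m≤n⇒m≤n⊔o y , m≤n⇒m≤o⊔n x ]′) 0 _
    (inj₂ (Any-map⁺ (Any.map (λ { refl → ≤-refl }) t∈)))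

mOf-≤ : ∀ {lam v} → (∀ {t} → t ∈ SYT lam → length (des (sum lam) t) ≤ v) → mOf lam ≤ v
mOf-≤ {v = v} bound = foldr-preservesᵇ {P = _≤ v} {f = _⊔_} ⊔-lub z≤n (All-map⁺ (All.tabulate bound))

sum-positive : ∀ {lam} → IsPartition lam → lam ≢ [] → 1 ≤ sum lam
sum-positive {[]}      _             lam≢[] = ⊥-elim (lam≢[] refl)
sum-positive {k ∷ lam} (1≤k ∷ _ , _) _      = ≤-trans 1≤k (m≤m+n k (sum lam))

length≤length-des : ∀ {lam t} → IsPartition lam → t ∈ SYT lam → length lam ≤ length (des (sum lam) t)
length≤length-des {[]}                 _           _  = z≤n
length≤length-des {k ∷ lam} {[]}       _           t∈ with () ← IsStandard.shape (SYT⇒IsStandard {k ∷ lam} t∈)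
length≤length-des {k ∷ lam} {r ∷ rows} (1≤lam , _) t∈ = begin
  length (k ∷ lam)                                  ≡⟨ length-shape {r ∷ rows} shape ⟨
  suc (length rows)                                 ≤⟨ s≤s (length-rows≤descents r rows std (All-shape shape 1≤lam)) ⟩
  suc (length (DesSet (sum (k ∷ lam)) (r ∷ rows)))  ≡⟨ length-des (sum (k ∷ lam)) (r ∷ rows) ⟨
  length (des (sum (k ∷ lam)) (r ∷ rows))           ∎
  where
  open ≤-Reasoning
  std : IsStandard (k ∷ lam) (r ∷ rows)
  std = SYT⇒IsStandard {k ∷ lam} t∈
  open IsStandard std using (shape)

length≤mOf : ∀ {lam} → IsPartition lam → length lam ≤ mOf lam
length≤mOf {lam} part =
  ≤-trans (length≤length-des part (superstandard∈SYT part)) (≤-mOf {lam} (superstandard∈SYT part))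

ones-after-one : ∀ {ν} → All (1 ≤_) ν → Linked (λ m n → n ≤ m) (1 ∷ ν) → All (_≡ 1) ν
ones-after-one {[]}    _            _           = []
ones-after-one {n ∷ ν} (1≤n ∷ 1≤ν) (n≤1 ∷ ≥ν) with refl ← ≤-antisym n≤1 1≤n = refl ∷ ones-after-one 1≤ν ≥ν

hook-tail-ones : ∀ {k lam} → IsPartition (k ∷ lam) → IsHook (k ∷ lam) → All (_≡ 1) lam
hook-tail-ones {lam = []}      _                             _   = []
hook-tail-ones {lam = l ∷ lam} (_ ∷ 1≤l ∷ 1≤lam , _ ∷ ≥lam) l≤1 with refl ← ≤-antisym l≤1 1≤l =
  refl ∷ ones-after-one 1≤lam ≥lam

hook⇒length-des≡length : ∀ {lam t} → IsPartition lam → lam ≢ [] → IsHook lam → t ∈ SYT lam →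
                         length (des (sum lam) t) ≡ length lam
hook⇒length-des≡length {[]}                 _    lam≢[] = ⊥-elim (lam≢[] refl)
hook⇒length-des≡length {k ∷ lam} {[]}       _    _ _ t∈ with () ← IsStandard.shape (SYT⇒IsStandard {k ∷ lam} t∈)
hook⇒length-des≡length {k ∷ lam} {r ∷ rows} part _ hook t∈ = ≤-antisym (begin
  length (des (sum (k ∷ lam)) (r ∷ rows))           ≡⟨ length-des (sum (k ∷ lam)) (r ∷ rows) ⟩
  suc (length (DesSet (sum (k ∷ lam)) (r ∷ rows)))  ≤⟨ s≤s (descents≤length-rows r rows std singletons) ⟩
  suc (length rows)                                 ≡⟨ length-shape {r ∷ rows} shape ⟩
  length (k ∷ lam)                                  ∎) (length≤length-des part t∈)
  where
  open ≤-Reasoning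
  std : IsStandard (k ∷ lam) (r ∷ rows)
  std = SYT⇒IsStandard {k ∷ lam} t∈
  open IsStandard std using (shape)
  singletons : All Singleton rows
  singletons = All-shape (∷-injectiveʳ shape) (hook-tail-ones part hook)

hook⇔length≡mOf : ∀ {lam} → IsPartition lam → lam ≢ [] → IsHook lam ⇔ (length lam ≡ mOf lam)
hook⇔length≡mOf {lam} part lam≢[] = mk⇔ hook⇒ ⇒hook
  where
  hook⇒ : IsHook lam → length lam ≡ mOf lam
  hook⇒ hook =
    ≤-antisym (length≤mOf part) (mOf-≤ {lam} (≤-reflexive ∘ hook⇒length-des≡length part lam≢[] hook))
  ⇒hook : length lam ≡ mOf lam → IsHook lam
  ⇒hook ℓ≡m with second lam ≤? 1
  ... | yes hook = hook
  ... | no ¬hook with t , t∈ , long ← nonHook-longDescent part ¬hook =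
    ⊥-elim (<⇒≱ long (≤-trans (≤-mOf {lam} t∈) (≤-reflexive (sym ℓ≡m))))

Sk-positive : ∀ {lam t} → t ∈ SYT lam → 1 ≤ Sk lam (des (sum lam) t)
Sk-positive {lam} {t} t∈ =
  Unique-⊆⇒length≤ ([] ∷ []) λ { (here refl) →
    ∈-filter⁺ (λ t' → ≡-dec _≟_ (des (sum lam) t') (des (sum lam) t)) {xs = SYT lam} t∈ refl }

Sk≡0 : ∀ lam {α} → (∀ {t} → t ∈ SYT lam → des (sum lam) t ≢ α) → Sk lam α ≡ 0
Sk≡0 lam {α} ≢α = cong length (filter-none (λ t → ≡-dec _≟_ (des (sum lam) t) α) (All.tabulate ≢α))

SkAt-on : ∀ lam {i α} → length α ≡ i → SkAt lam i α ≡ Sk lam α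
SkAt-on lam {i} {α} |α|≡i with length α ≡ᵇ i | ≡⇒≡ᵇ (length α) i |α|≡i
... | true | _ = refl

SkAt-off : ∀ lam {i α} → length α ≢ i → SkAt lam i α ≡ 0
SkAt-off lam {i} {α} |α|≢i with length α ≡ᵇ i in eq
... | false = refl
... | true  = ⊥-elim (|α|≢i (≡ᵇ⇒≡ (length α) i (subst T (sym eq) _)))

hook⇔Sk≡SkAt : ∀ {lam} → IsPartition lam → lam ≢ [] →
               IsHook lam ⇔ ((α : List ℕ) → IsComposition (sum lam) α → Sk lam α ≡ SkAt lam (length lam) α)
hook⇔Sk≡SkAt {lam} part lam≢[] = mk⇔ hook⇒ ⇒hook
  where
  n : ℕ
  n = sum lam
  hook⇒ : IsHook lam → (α : List ℕ) → IsComposition n α → Sk lam α ≡ SkAt lam (length lam) α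
  hook⇒ hook α _ with length α ≟ length lam
  ... | yes |α|≡ℓ = sym (SkAt-on lam |α|≡ℓ)
  ... | no  |α|≢ℓ = ≡-trans (Sk≡0 lam λ t∈ des≡α → |α|≢ℓ (≡-trans (cong length (sym des≡α))
                                                                 (hook⇒length-des≡length part lam≢[] hook t∈)))
                            (sym (SkAt-off lam |α|≢ℓ))
  ⇒hook : ((α : List ℕ) → IsComposition n α → Sk lam α ≡ SkAt lam (length lam) α) → IsHook lam
  ⇒hook Sk≡SkAt with second lam ≤? 1
  ... | yes hook = hook
  ... | no ¬hook with t , t∈ , long ← nonHook-longDescent part ¬hook = ⊥-elim (1+n≰n (begin
    1                                  ≤⟨ Sk-positive {lam} t∈ ⟩
    Sk lam (des n t)                   ≡⟨ Sk≡SkAt (des n t) (des-isComposition n t (sum-positive part lam≢[])) ⟩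
    SkAt lam (length lam) (des n t)    ≡⟨ SkAt-off lam (>⇒≢ long) ⟩
    0                                  ∎))
    where open ≤-Reasoning

mainTheorem17 : (lam : List ℕ) → IsPartition lam → lam ≢ [] →
    (IsHook lam ⇔ (length lam ≡ mOf lam)) ×
    ((length lam ≡ mOf lam) ⇔
      ((α : List ℕ) → IsComposition (sum lam) α → Sk lam α ≡ SkAt lam (length lam) α))
mainTheorem17 lam part lam≢[] =
  hook⇔length≡mOf part lam≢[] , ⇔-trans (⇔-sym (hook⇔length≡mOf part lam≢[])) (hook⇔Sk≡SkAt part lam≢[])
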